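{- Let $G=(K,I;E)$ be a split graph, $c\ge1$ and $k\ge0$ integers, $C \subseteq K$ and $v\in K\setminus C$ with $|C \cup\{v\}|\le c$. If $T_C$ and $T_{C\cup\{v\}}$ are $c$-colorable sets of size at least $k$, then there is a $\mathsf{TAR}_k$-sequence between $T_C$ and $T_{C\cup\{v\}}$ if and only if $|T_{C\cup\{v\}}|\ge k+1$.
   Context: A split graph $G=(K,I;E)$ has vertex set partitioned into a clique $K$ and an independent set $I$. A set $S\subseteq V(G)$ is $c$-colorable if $G[S]$ has a proper $c$-coloring. For $C \subseteq K$ with $|C|\le c$, define $T_C = C \cup I$ if $|C|<c$, and $T_C = (C\cup I)\setminus\{u \in I : C \subseteq N_G(u)\}$ if $|C|=c$, where $N_G(u)$ is the neighborhood of $u$. For $c$-colorable sets $S,T$, $S \leftrightarrow T$ under $\mathsf{TAR}_k$ means $|S|,|T|\ge k$ and $|S\triangle T|=1$; a $\mathsf{TAR}_k$-sequence between $S_0$ and $S_\ell$ is a sequence $\langle S_0,\dots,S_\ell\rangle$ of $c$-colorable sets with $S_{i-1}\leftrightarrow S_i$ under $\mathsf{TAR}_k$ for all $i$. -}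

module Defs where

open import Data.Nat using (ℕ; _<_; _≤_; _≥_; _<ᵇ_; suc)
open import Data.Bool using (Bool; true; false; _∧_; if_then_else_)
open import Data.Fin using (Fin)
open import Data.Fin.Subset using (Subset; _∈_; _∉_; _⊆_; _∪_; _─_; ∁; ∣_∣)
open import Data.Fin.Subset.Properties using (_∈?_; _⊆?_)
open import Data.Vec using (tabulate)
open import Data.Product using (Σ; _×_)
open import Relation.Binary.PropositionalEquality using (_≡_; _≢_)
open import Relation.Nullary.Decidable using (⌊_⌋)

Adjacent : {n : ℕ} → (Fin n → Fin n → Bool) → Fin n → Fin n → Set
Adjacent adj u v = adj u v ≡ true

record SplitGraph (n : ℕ) : Set where
  field
    adj         : Fin n → Fin n → Bool
    adj-sym     : ∀ u v → adj u v ≡ adj v u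
    adj-irrefl  : ∀ u → adj u u ≡ false
    K           : Subset n
    clique      : ∀ u v → u ∈ K → v ∈ K → u ≢ v → Adjacent adj u v
    independent : ∀ u v → u ∉ K → v ∉ K → adj u v ≡ false

  I : Subset n
  I = ∁ K

  N : Fin n → Subset n
  N u = tabulate (adj u)

open SplitGraph public

Colorable : {n : ℕ} → SplitGraph n → ℕ → Subset n → Set
Colorable G c S =
  Σ (Fin _ → Fin c) λ f →
    ∀ u v → u ∈ S → v ∈ S → Adjacent (adj G) u v → f u ≢ f v

T : {n : ℕ} → SplitGraph n → ℕ → Subset n → Subset n
T {n} G c C =
  if ∣ C ∣ <ᵇ c
  then C ∪ I G
  else (C ∪ I G) ─ tabulate (λ u → ⌊ u ∈? I G ⌋ ∧ ⌊ C ⊆? N G u ⌋)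

_△_ : {n : ℕ} → Subset n → Subset n → Subset n
S △ S' = (S ─ S') ∪ (S' ─ S)

TARStep : {n : ℕ} → ℕ → Subset n → Subset n → Set
TARStep k S S' = ∣ S ∣ ≥ k × ∣ S' ∣ ≥ k × ∣ S △ S' ∣ ≡ 1

data TARSeq {n : ℕ} (G : SplitGraph n) (c k : ℕ) : Subset n → Subset n → Set where
  done : ∀ {S} → Colorable G c S → TARSeq G c k S S
  step : ∀ {S S' S''} → Colorable G c S → TARStep k S S' →
         TARSeq G c k S' S'' → TARSeq G c k S S''

-- When |C ∪ {v}| < c, T_C ⊂ T_{C∪{v}} and the claim is immediate. When |C ∪ {v}| = c,
-- T_{C∪{v}} is a maximal c-colourable set: a vertex outside it is adjacent to every vertex of
-- C ∪ {v} (through the clique K, or because T removed exactly such vertices of I), so adding it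
-- would create a clique on c + 1 vertices. Since v ∈ T_{C∪{v}} ∖ T_C, a TAR_k-sequence must
-- therefore enter T_{C∪{v}} by an addition to a set of size at least k. Conversely, if
-- |T_{C∪{v}}| ≥ k + 1 then R = T_{C∪{v}} ∖ {v} ⊆ T_C has size at least k, so deleting the
-- vertices of T_C ∖ R one at a time and then adding v is a TAR_k-sequence.
module Submission where

open import Defs
open import Data.Nat using (ℕ; _≤_; _≥_; _<_; _<ᵇ_; suc; zero; z≤n; s≤s; _<?_)
open import Data.Nat.Properties
  using (≤-trans; ≤-reflexive; ≤-pred; ≤-<-trans; <⇒≱; ≮⇒≥; <⇒<ᵇ)
open import Data.Nat.Induction using (<-wellFounded)
open import Induction.WellFounded using (Acc; acc)
open import Data.Fin using (Fin; zero; suc; punchOut)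
open import Data.Fin.Properties using (suc-injective; punchOut-injective) renaming (_≟_ to _≟ᶠ_)
open import Data.Fin.Subset using (Subset; _∈_; _∉_; _⊆_; _⊂_; _∪_; _─_; _-_; ⁅_⁆; ∣_∣; Empty)
open import Data.Fin.Subset.Properties
  using ( _∈?_; nonempty?; drop-there; x∈⁅x⁆; x∈⁅y⁆⇒x≡y; ∣⁅x⁆∣≡1; ∣⊥∣≡0; Empty-unique
        ; ⊆-antisym; p⊆q⇒∣p∣≤∣q∣; p⊂q⇒∣p∣<∣q∣; x∈p⇒∣p-x∣<∣p∣; x∈p∪q⁻; x∈p∪q⁺; ∣p∣≤∣p∪q∣
        ; ∪-comm; ∪-identity; _⊆?_; x∈p∧x∉q⇒x∈p─q; x∈p∧x≢y⇒x∈p-y; p─q⊆p; x∉p⇒x∈∁p; x∈∁p⇒x∉p)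
open import Data.Bool using (Bool; true; false; _∧_; if_then_else_)
open import Data.Bool.Properties using (T-≡; T-∧)
open import Data.Vec using (_∷_; []; tabulate; here; there)
open import Data.Vec.Properties using ([]=⇒lookup; lookup∘tabulate)
open import Data.Product as Product using (∃; _×_; _,_; proj₁; proj₂)
open import Data.Sum using (_⊎_; inj₁; inj₂)
open import Function using (_∘_; id; case_of_)
open import Function.Bundles using (_⇔_; mk⇔; Equivalence)
open import Relation.Nullary using (yes; no; ¬_; contradiction)
open import Relation.Nullary.Decidable using (⌊_⌋; toWitness)
open import Relation.Binary.PropositionalEquality using (_≡_; _≢_; refl; sym; trans; cong; subst; module ≡-Reasoning)

if-true : ∀ {a} {A : Set a} {b} {x y : A} → b ≡ true → (if b then x else y) ≡ x
if-true refl = refl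

if-elim : ∀ {a p} {A : Set a} (P : A → Set p) b {x y : A} → P x → P y → P (if b then x else y)
if-elim P true  px _  = px
if-elim P false _  py = py

∈-tabulate⁻ : ∀ {n} {f : Fin n → Bool} {x} → x ∈ tabulate f → f x ≡ true
∈-tabulate⁻ {f = f} {x} x∈ = trans (sym (lookup∘tabulate f x)) ([]=⇒lookup x∈)

x∈p─q⁻ : ∀ {n} {x : Fin n} (p q : Subset n) → x ∈ p ─ q → x ∈ p × x ∉ q
x∈p─q⁻ (true ∷ p)  (false ∷ q) here       = here , λ ()
x∈p─q⁻ {x = zero} (_ ∷ p)     (true ∷ q)  ()
x∈p─q⁻ {x = zero} (false ∷ p) (false ∷ q) ()
x∈p─q⁻ (_ ∷ p)    (_ ∷ q)     (there x∈) = Product.map there (λ x∉q → x∉q ∘ drop-there) (x∈p─q⁻ p q x∈)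

x∉p-x : ∀ {n} (p : Subset n) x → x ∉ p - x
x∉p-x p x x∈ = proj₂ (x∈p─q⁻ p ⁅ x ⁆ x∈) (x∈⁅x⁆ x)

Empty[p─q]⇒p⊆q : ∀ {n} (p q : Subset n) → Empty (p ─ q) → p ⊆ q
Empty[p─q]⇒p⊆q p q empty {x} x∈p with x ∈? q
... | yes x∈q = x∈q
... | no  x∉q = contradiction (x , x∈p∧x∉q⇒x∈p─q x∈p x∉q) empty

x∈p⇒p-x∪⁅x⁆≡p : ∀ {n} {p : Subset n} {x} → x ∈ p → (p - x) ∪ ⁅ x ⁆ ≡ p
x∈p⇒p-x∪⁅x⁆≡p {p = p} {x} x∈p = ⊆-antisym ⊆p ⊇p
  where
  ⊆p : (p - x) ∪ ⁅ x ⁆ ⊆ p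
  ⊆p y∈ with x∈p∪q⁻ (p - x) ⁅ x ⁆ y∈
  ... | inj₁ y∈p-x = p─q⊆p p ⁅ x ⁆ y∈p-x
  ... | inj₂ y∈⁅x⁆ = subst (_∈ p) (sym (x∈⁅y⁆⇒x≡y x y∈⁅x⁆)) x∈p
  ⊇p : p ⊆ (p - x) ∪ ⁅ x ⁆
  ⊇p {y} y∈p with y ≟ᶠ x
  ... | yes refl = x∈p∪q⁺ (inj₂ (x∈⁅x⁆ x))
  ... | no  y≢x  = x∈p∪q⁺ (inj₁ (x∈p∧x≢y⇒x∈p-y y∈p y≢x))

∣p∪⁅x⁆∣≡1+∣p∣ : ∀ {n} (p : Subset n) {x} → x ∉ p → ∣ p ∪ ⁅ x ⁆ ∣ ≡ suc ∣ p ∣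
∣p∪⁅x⁆∣≡1+∣p∣ (true ∷ p)  {zero}  x∉p = contradiction here x∉p
∣p∪⁅x⁆∣≡1+∣p∣ (false ∷ p) {zero}  x∉p = cong (suc ∘ ∣_∣) (proj₂ ∪-identity p)
∣p∪⁅x⁆∣≡1+∣p∣ (true ∷ p)  {suc x} x∉p = cong suc (∣p∪⁅x⁆∣≡1+∣p∣ p (x∉p ∘ there))
∣p∪⁅x⁆∣≡1+∣p∣ (false ∷ p) {suc x} x∉p = ∣p∪⁅x⁆∣≡1+∣p∣ p (x∉p ∘ there)

x∈p⇒∣p∣≡1+∣p-x∣ : ∀ {n} {p : Subset n} {x} → x ∈ p → ∣ p ∣ ≡ suc ∣ p - x ∣
x∈p⇒∣p∣≡1+∣p-x∣ {p = p} {x} x∈p = begin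
  ∣ p ∣                 ≡⟨ cong ∣_∣ (sym (x∈p⇒p-x∪⁅x⁆≡p x∈p)) ⟩
  ∣ (p - x) ∪ ⁅ x ⁆ ∣   ≡⟨ ∣p∪⁅x⁆∣≡1+∣p∣ (p - x) (x∉p-x p x) ⟩
  suc ∣ p - x ∣         ∎
  where open ≡-Reasoning

∣p∣≤1∧x∈p∧y∈p⇒y≡x : ∀ {n} {p : Subset n} {x y} → ∣ p ∣ ≤ 1 → x ∈ p → y ∈ p → y ≡ x
∣p∣≤1∧x∈p∧y∈p⇒y≡x {p = p} {x} {y} ∣p∣≤1 x∈p y∈p with y ≟ᶠ x
... | yes y≡x = y≡x
... | no  y≢x = contradiction ∣p∣≤1 (<⇒≱ (≤-<-trans 1≤∣p-x∣ (x∈p⇒∣p-x∣<∣p∣ x∈p)))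
  where
  ⁅y⁆⊆p-x : ⁅ y ⁆ ⊆ p - x
  ⁅y⁆⊆p-x z∈⁅y⁆ = subst (_∈ p - x) (sym (x∈⁅y⁆⇒x≡y y z∈⁅y⁆)) (x∈p∧x≢y⇒x∈p-y y∈p y≢x)
  1≤∣p-x∣ : 1 ≤ ∣ p - x ∣
  1≤∣p-x∣ = subst (_≤ ∣ p - x ∣) (∣⁅x⁆∣≡1 y) (p⊆q⇒∣p∣≤∣q∣ ⁅y⁆⊆p-x)

sole-difference⇒⊂ : ∀ {n} {p q : Subset n} {x} → (∀ {y} → y ∈ p ─ q → y ≡ x) → x ∈ q ─ p → p ⊂ q
sole-difference⇒⊂ {p = p} {q} {x} sole x∈q─p = p⊆q , x , x∈q , x∉p
  where
  x∈q = proj₁ (x∈p─q⁻ q p x∈q─p)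
  x∉p = proj₂ (x∈p─q⁻ q p x∈q─p)
  p⊆q : p ⊆ q
  p⊆q {y} y∈p with y ∈? q
  ... | yes y∈q = y∈q
  ... | no  y∉q = contradiction (subst (_∈ p) (sole (x∈p∧x∉q⇒x∈p─q y∈p y∉q)) y∈p) x∉p

∣p△q∣≡1⇒p⊂q⊎q⊂p : ∀ {n} (p q : Subset n) → ∣ p △ q ∣ ≡ 1 → p ⊂ q ⊎ q ⊂ p
∣p△q∣≡1⇒p⊂q⊎q⊂p {n} p q ∣p△q∣≡1 with nonempty? (p △ q)
... | no empty = case trans (sym ∣p△q∣≡1) (trans (cong ∣_∣ (Empty-unique empty)) (∣⊥∣≡0 n)) of λ ()
... | yes (x , x∈p△q) = split (x∈p∪q⁻ (p ─ q) (q ─ p) x∈p△q)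
  where
  sole : ∀ {y} → y ∈ p △ q → y ≡ x
  sole = ∣p∣≤1∧x∈p∧y∈p⇒y≡x (≤-reflexive ∣p△q∣≡1) x∈p△q
  split : x ∈ p ─ q ⊎ x ∈ q ─ p → p ⊂ q ⊎ q ⊂ p
  split (inj₁ x∈p─q) = inj₂ (sole-difference⇒⊂ (sole ∘ x∈p∪q⁺ ∘ inj₂) x∈p─q)
  split (inj₂ x∈q─p) = inj₁ (sole-difference⇒⊂ (sole ∘ x∈p∪q⁺ ∘ inj₁) x∈q─p)

p△p∪⁅x⁆≡⁅x⁆ : ∀ {n} {p : Subset n} {x} → x ∉ p → p △ (p ∪ ⁅ x ⁆) ≡ ⁅ x ⁆
p△p∪⁅x⁆≡⁅x⁆ {p = p} {x} x∉p = ⊆-antisym ⊆⁅x⁆ ⁅x⁆⊆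
  where
  ⊆⁅x⁆ : p △ (p ∪ ⁅ x ⁆) ⊆ ⁅ x ⁆
  ⊆⁅x⁆ y∈ with x∈p∪q⁻ (p ─ (p ∪ ⁅ x ⁆)) ((p ∪ ⁅ x ⁆) ─ p) y∈
  ... | inj₁ y∈p─ = let y∈p , y∉p∪⁅x⁆ = x∈p─q⁻ p (p ∪ ⁅ x ⁆) y∈p─
                    in contradiction (x∈p∪q⁺ (inj₁ y∈p)) y∉p∪⁅x⁆
  ... | inj₂ y∈─p with x∈p─q⁻ (p ∪ ⁅ x ⁆) p y∈─p
  ...   | y∈p∪⁅x⁆ , y∉p with x∈p∪q⁻ p ⁅ x ⁆ y∈p∪⁅x⁆
  ...     | inj₁ y∈p   = contradiction y∈p y∉p
  ...     | inj₂ y∈⁅x⁆ = y∈⁅x⁆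
  ⁅x⁆⊆ : ⁅ x ⁆ ⊆ p △ (p ∪ ⁅ x ⁆)
  ⁅x⁆⊆ y∈⁅x⁆ with x∈⁅y⁆⇒x≡y x y∈⁅x⁆
  ... | refl = x∈p∪q⁺ (inj₂ (x∈p∧x∉q⇒x∈p─q (x∈p∪q⁺ (inj₂ (x∈⁅x⁆ x))) x∉p))

injection⇒∣p∣≤m : ∀ {n m} (p : Subset n) (f : ∀ u → u ∈ p → Fin m) →
                  (∀ {u w} (u∈p : u ∈ p) (w∈p : w ∈ p) → f u u∈p ≡ f w w∈p → u ≡ w) → ∣ p ∣ ≤ m
injection⇒∣p∣≤m []          f inj = z≤n
injection⇒∣p∣≤m (false ∷ p) f inj =
  injection⇒∣p∣≤m p (λ u u∈p → f (suc u) (there u∈p))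
                    (λ u∈p w∈p → suc-injective ∘ inj (there u∈p) (there w∈p))
injection⇒∣p∣≤m {m = zero}  (true ∷ p) f inj with f zero here
... | ()
injection⇒∣p∣≤m {m = suc m} (true ∷ p) f inj = s≤s (injection⇒∣p∣≤m p f′ inj′)
  where
  f0≢ : ∀ {u} (u∈p : u ∈ p) → f zero here ≢ f (suc u) (there u∈p)
  f0≢ u∈p e = case inj here (there u∈p) e of λ ()
  f′ : ∀ u → u ∈ p → Fin m
  f′ u u∈p = punchOut (f0≢ u∈p)
  inj′ : ∀ {u w} (u∈p : u ∈ p) (w∈p : w ∈ p) → f′ u u∈p ≡ f′ w w∈p → u ≡ w
  inj′ u∈p w∈p = suc-injective ∘ inj (there u∈p) (there w∈p) ∘ punchOut-injective (f0≢ u∈p) (f0≢ w∈p)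

module _ {n : ℕ} (G : SplitGraph n) where

  IsClique : Subset n → Set
  IsClique A = ∀ {u w} → u ∈ A → w ∈ A → u ≢ w → Adjacent (adj G) u w

  K-clique : ∀ {A} → A ⊆ K G → IsClique A
  K-clique A⊆K u∈A w∈A = clique G _ _ (A⊆K u∈A) (A⊆K w∈A)

  IsClique-∪⁅x⁆ : ∀ {A x} → IsClique A → (∀ {u} → u ∈ A → u ≢ x → Adjacent (adj G) u x) →
                  IsClique (A ∪ ⁅ x ⁆)
  IsClique-∪⁅x⁆ {A} {x} A-clique toX u∈ w∈ u≢w with x∈p∪q⁻ A ⁅ x ⁆ u∈ | x∈p∪q⁻ A ⁅ x ⁆ w∈
  ... | inj₁ u∈A | inj₁ w∈A = A-clique u∈A w∈A u≢w
  ... | inj₁ u∈A | inj₂ w∈⁅x⁆ rewrite x∈⁅y⁆⇒x≡y x w∈⁅x⁆ = toX u∈A u≢w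
  ... | inj₂ u∈⁅x⁆ | inj₁ w∈A rewrite x∈⁅y⁆⇒x≡y x u∈⁅x⁆ =
    trans (adj-sym G x _) (toX w∈A (u≢w ∘ sym))
  ... | inj₂ u∈⁅x⁆ | inj₂ w∈⁅x⁆ =
    contradiction (trans (x∈⁅y⁆⇒x≡y x u∈⁅x⁆) (sym (x∈⁅y⁆⇒x≡y x w∈⁅x⁆))) u≢w

  completeTo : Subset n → Subset n
  completeTo C = tabulate (λ u → ⌊ u ∈? I G ⌋ ∧ ⌊ C ⊆? N G u ⌋)

  ∈completeTo⁻ : ∀ {C x} → x ∈ completeTo C → x ∈ I G × C ⊆ N G x
  ∈completeTo⁻ {C} {x} x∈ =
    Product.map (toWitness {a? = x ∈? I G}) (toWitness {a? = C ⊆? N G x})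
                (Equivalence.to T-∧ (Equivalence.from T-≡ (∈-tabulate⁻ x∈)))

  module _ (c : ℕ) where

    Colorable-⊆ : ∀ {S S′} → S ⊆ S′ → Colorable G c S′ → Colorable G c S
    Colorable-⊆ S⊆S′ (colour , proper) = colour , λ u w u∈S w∈S → proper u w (S⊆S′ u∈S) (S⊆S′ w∈S)

    clique⇒∣A∣≤c : ∀ {S A} → Colorable G c S → A ⊆ S → IsClique A → ∣ A ∣ ≤ c
    clique⇒∣A∣≤c {A = A} (colour , proper) A⊆S A-clique = injection⇒∣p∣≤m _ (λ u _ → colour u) distinct
      where
      distinct : ∀ {u w} → u ∈ A → w ∈ A → colour u ≡ colour w → u ≡ w
      distinct {u} {w} u∈A w∈A same with u ≟ᶠ w
      ... | yes u≡w = u≡w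
      ... | no  u≢w = contradiction same (proper u w (A⊆S u∈A) (A⊆S w∈A) (A-clique u∈A w∈A u≢w))

    T≡C∪I : ∀ {C} → ∣ C ∣ < c → T G c C ≡ C ∪ I G
    T≡C∪I ∣C∣<c = if-true (Equivalence.to T-≡ (<⇒<ᵇ ∣C∣<c))

    T⊆C∪I : ∀ C → T G c C ⊆ C ∪ I G
    T⊆C∪I C = if-elim (_⊆ C ∪ I G) (∣ C ∣ <ᵇ c) id (p─q⊆p _ _)

    C⊆T : ∀ {C} → C ⊆ K G → C ⊆ T G c C
    C⊆T {C} C⊆K {y} y∈C = if-elim (y ∈_) (∣ C ∣ <ᵇ c) y∈C∪I
      (x∈p∧x∉q⇒x∈p─q y∈C∪I (λ y∈ → x∈∁p⇒x∉p (proj₁ (∈completeTo⁻ y∈)) (C⊆K y∈C)))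
      where y∈C∪I = x∈p∪q⁺ (inj₁ y∈C)

    ∉T : ∀ {C x} → x ∉ C → x ∈ K G → x ∉ T G c C
    ∉T {C} x∉C x∈K x∈T with x∈p∪q⁻ C (I G) (T⊆C∪I C x∈T)
    ... | inj₁ x∈C = x∉C x∈C
    ... | inj₂ x∈I = x∈∁p⇒x∉p x∈I x∈K

    ∉T⇒⊆N : ∀ {C x} → x ∈ I G → x ∉ T G c C → C ⊆ N G x
    ∉T⇒⊆N {C} {x} x∈I =
      if-elim (λ S → x ∉ S → C ⊆ N G x) (∣ C ∣ <ᵇ c)
        (λ x∉C∪I → contradiction (x∈p∪q⁺ (inj₂ x∈I)) x∉C∪I)
        (λ x∉ → proj₂ (∈completeTo⁻ (∉T⇒∈completeTo x∉)))
      where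
      ∉T⇒∈completeTo : x ∉ (C ∪ I G) ─ completeTo C → x ∈ completeTo C
      ∉T⇒∈completeTo x∉ with x ∈? completeTo C
      ... | yes x∈ = x∈
      ... | no  x∉′ = contradiction (x∈p∧x∉q⇒x∈p─q (x∈p∪q⁺ (inj₂ x∈I)) x∉′) x∉

    T-maximal : ∀ {C S} → c ≤ ∣ C ∣ → C ⊆ K G → Colorable G c S → ¬ (T G c C ⊂ S)
    T-maximal {C} {S} c≤∣C∣ C⊆K colS (T⊆S , x , x∈S , x∉T) =
      <⇒≱ (subst (_≤ c) (∣p∪⁅x⁆∣≡1+∣p∣ C x∉C) (clique⇒∣A∣≤c colS C∪x⊆S C∪x-clique)) c≤∣C∣
      where
      x∉C : x ∉ C
      x∉C = x∉T ∘ C⊆T C⊆K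
      C∪x⊆S : C ∪ ⁅ x ⁆ ⊆ S
      C∪x⊆S y∈ with x∈p∪q⁻ C ⁅ x ⁆ y∈
      ... | inj₁ y∈C   = T⊆S (C⊆T C⊆K y∈C)
      ... | inj₂ y∈⁅x⁆ = subst (_∈ S) (sym (x∈⁅y⁆⇒x≡y x y∈⁅x⁆)) x∈S
      C-toX : ∀ {u} → u ∈ C → u ≢ x → Adjacent (adj G) u x
      C-toX {u} u∈C u≢x with x ∈? K G
      ... | yes x∈K = clique G u x (C⊆K u∈C) x∈K u≢x
      ... | no  x∉K = trans (adj-sym G u x)
                            (∈-tabulate⁻ (∉T⇒⊆N (x∉p⇒x∈∁p x∉K) x∉T u∈C))
      C∪x-clique : IsClique (C ∪ ⁅ x ⁆)
      C∪x-clique = IsClique-∪⁅x⁆ (K-clique C⊆K) C-toX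

    T⊂T∪⁅v⁆ : ∀ {C v} → ∣ C ∪ ⁅ v ⁆ ∣ < c → v ∈ K G → v ∉ C → T G c C ⊂ T G c (C ∪ ⁅ v ⁆)
    T⊂T∪⁅v⁆ {C} {v} ∣C∪v∣<c v∈K v∉C = T⊆T′ , v , v∈T′ , ∉T v∉C v∈K
      where
      T′≡ : T G c (C ∪ ⁅ v ⁆) ≡ (C ∪ ⁅ v ⁆) ∪ I G
      T′≡ = T≡C∪I ∣C∪v∣<c
      v∈T′ : v ∈ T G c (C ∪ ⁅ v ⁆)
      v∈T′ = subst (v ∈_) (sym T′≡) (x∈p∪q⁺ (inj₁ (x∈p∪q⁺ (inj₂ (x∈⁅x⁆ v)))))
      T⊆T′ : T G c C ⊆ T G c (C ∪ ⁅ v ⁆)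
      T⊆T′ {y} y∈T with x∈p∪q⁻ C (I G) (T⊆C∪I C y∈T)
      ... | inj₁ y∈C = subst (y ∈_) (sym T′≡) (x∈p∪q⁺ (inj₁ (x∈p∪q⁺ (inj₁ y∈C))))
      ... | inj₂ y∈I = subst (y ∈_) (sym T′≡) (x∈p∪q⁺ (inj₂ y∈I))

    T∪⁅v⁆-v⊆T : ∀ {C v} → ∣ C ∣ < c → T G c (C ∪ ⁅ v ⁆) - v ⊆ T G c C
    T∪⁅v⁆-v⊆T {C} {v} ∣C∣<c {y} y∈ with x∈p─q⁻ (T G c (C ∪ ⁅ v ⁆)) ⁅ v ⁆ y∈
    ... | y∈T′ , y∉⁅v⁆ = subst (y ∈_) (sym (T≡C∪I ∣C∣<c)) (x∈p∪q⁺ y∈C⊎I)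
      where
      y∈C⊎I : y ∈ C ⊎ y ∈ I G
      y∈C⊎I with x∈p∪q⁻ (C ∪ ⁅ v ⁆) (I G) (T⊆C∪I (C ∪ ⁅ v ⁆) y∈T′)
      ... | inj₂ y∈I = inj₂ y∈I
      ... | inj₁ y∈C∪v with x∈p∪q⁻ C ⁅ v ⁆ y∈C∪v
      ...   | inj₁ y∈C = inj₁ y∈C
      ...   | inj₂ y∈⁅v⁆ = contradiction y∈⁅v⁆ y∉⁅v⁆

module _ {n : ℕ} (k : ℕ) where

  TARStep-sym : ∀ {S S′ : Subset n} → TARStep k S S′ → TARStep k S′ S
  TARStep-sym {S} {S′} (k≤∣S∣ , k≤∣S′∣ , ∣S△S′∣≡1) =
    k≤∣S′∣ , k≤∣S∣ , trans (cong ∣_∣ (∪-comm (S′ ─ S) (S ─ S′))) ∣S△S′∣≡1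

  TARStep-insert : ∀ {S : Subset n} {x} → x ∉ S → k ≤ ∣ S ∣ → TARStep k S (S ∪ ⁅ x ⁆)
  TARStep-insert {S} {x} x∉S k≤∣S∣ =
    k≤∣S∣ , ≤-trans k≤∣S∣ (∣p∣≤∣p∪q∣ S ⁅ x ⁆) , trans (cong ∣_∣ (p△p∪⁅x⁆≡⁅x⁆ x∉S)) (∣⁅x⁆∣≡1 x)

  TARStep-delete : ∀ {S : Subset n} {x} → x ∈ S → k ≤ ∣ S - x ∣ → TARStep k S (S - x)
  TARStep-delete {S} {x} x∈S k≤∣S-x∣ =
    TARStep-sym {S - x} {S}
      (subst (TARStep k (S - x)) (x∈p⇒p-x∪⁅x⁆≡p x∈S) (TARStep-insert (x∉p-x S x) k≤∣S-x∣))

module _ {n : ℕ} (G : SplitGraph n) (c k : ℕ) where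

  TARSeq-⊇ : ∀ {R Z} S → Colorable G c S → R ⊆ S → k ≤ ∣ R ∣ → TARSeq G c k R Z → TARSeq G c k S Z
  TARSeq-⊇ {R} {Z} S₀ colS₀ R⊆S₀ k≤∣R∣ seq = go S₀ (<-wellFounded ∣ S₀ ∣) colS₀ R⊆S₀
    where
    go : ∀ S → Acc _<_ ∣ S ∣ → Colorable G c S → R ⊆ S → TARSeq G c k S Z
    go S (acc smaller) colS R⊆S with nonempty? (S ─ R)
    ... | no empty = subst (λ X → TARSeq G c k X Z) (⊆-antisym R⊆S (Empty[p─q]⇒p⊆q S R empty)) seq
    ... | yes (x , x∈S─R) =
      step colS (TARStep-delete k x∈S (≤-trans k≤∣R∣ (p⊆q⇒∣p∣≤∣q∣ R⊆S-x)))
           (go (S - x) (smaller (x∈p⇒∣p-x∣<∣p∣ x∈S)) (Colorable-⊆ G c (p─q⊆p S ⁅ x ⁆) colS) R⊆S-x)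
      where
      x∈S = proj₁ (x∈p─q⁻ S R x∈S─R)
      R⊆S-x : R ⊆ S - x
      R⊆S-x y∈R = x∈p∧x≢y⇒x∈p-y (R⊆S y∈R) (λ { refl → proj₂ (x∈p─q⁻ S R x∈S─R) y∈R })

  TARSeq-lastStep : ∀ {S Z} → S ≢ Z → TARSeq G c k S Z → ∃ λ S₀ → Colorable G c S₀ × TARStep k S₀ Z
  TARSeq-lastStep S≢Z (done _)            = contradiction refl S≢Z
  TARSeq-lastStep _   (step colS st rest) = lastStep colS st rest
    where
    lastStep : ∀ {S S′ Z} → Colorable G c S → TARStep k S S′ → TARSeq G c k S′ Z →
               ∃ λ S₀ → Colorable G c S₀ × TARStep k S₀ Z
    lastStep colS st (done _)                = _ , colS , st
    lastStep _    _  (step colS′ st′ rest′) = lastStep colS′ st′ rest′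

lemma19 : {n : ℕ} (G : SplitGraph n) (c k : ℕ) → c ≥ 1 →
    (C : Subset n) (v : Fin n) → C ⊆ K G → v ∈ K G → v ∉ C →
    ∣ C ∪ ⁅ v ⁆ ∣ ≤ c →
    Colorable G c (T G c C) → ∣ T G c C ∣ ≥ k →
    Colorable G c (T G c (C ∪ ⁅ v ⁆)) → ∣ T G c (C ∪ ⁅ v ⁆) ∣ ≥ k →
    TARSeq G c k (T G c C) (T G c (C ∪ ⁅ v ⁆)) ⇔ (∣ T G c (C ∪ ⁅ v ⁆) ∣ ≥ suc k)
lemma19 G c k _ C v C⊆K v∈K v∉C ∣C∪v∣≤c colT ∣T∣≥k colT′ _ = mk⇔ forward backward
  where
  T₀ = T G c C
  T′ = T G c (C ∪ ⁅ v ⁆)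
  C∪v⊆K : C ∪ ⁅ v ⁆ ⊆ K G
  C∪v⊆K y∈ with x∈p∪q⁻ C ⁅ v ⁆ y∈
  ... | inj₁ y∈C   = C⊆K y∈C
  ... | inj₂ y∈⁅v⁆ = subst (_∈ K G) (sym (x∈⁅y⁆⇒x≡y v y∈⁅v⁆)) v∈K
  v∈T′ : v ∈ T′
  v∈T′ = C⊆T G c C∪v⊆K (x∈p∪q⁺ (inj₂ (x∈⁅x⁆ v)))
  T₀≢T′ : T₀ ≢ T′
  T₀≢T′ T₀≡T′ = ∉T G c v∉C v∈K (subst (v ∈_) (sym T₀≡T′) v∈T′)

  forward : TARSeq G c k T₀ T′ → ∣ T′ ∣ ≥ suc k
  forward seq with ∣ C ∪ ⁅ v ⁆ ∣ <? c
  ... | yes ∣C∪v∣<c = ≤-<-trans ∣T∣≥k (p⊂q⇒∣p∣<∣q∣ (T⊂T∪⁅v⁆ G c ∣C∪v∣<c v∈K v∉C))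
  ... | no  ∣C∪v∣≮c with TARSeq-lastStep G c k T₀≢T′ seq
  ...   | S₀ , colS₀ , k≤∣S₀∣ , _ , ∣S₀△T′∣≡1 with ∣p△q∣≡1⇒p⊂q⊎q⊂p S₀ T′ ∣S₀△T′∣≡1
  ...     | inj₁ S₀⊂T′ = ≤-<-trans k≤∣S₀∣ (p⊂q⇒∣p∣<∣q∣ S₀⊂T′)
  ...     | inj₂ T′⊂S₀ = contradiction T′⊂S₀ (T-maximal G c (≮⇒≥ ∣C∪v∣≮c) C∪v⊆K colS₀)

  backward : ∣ T′ ∣ ≥ suc k → TARSeq G c k T₀ T′
  backward ∣T′∣>k =
    TARSeq-⊇ G c k T₀ colT R⊆T₀ k≤∣R∣ (step (Colorable-⊆ G c R⊆T₀ colT) R→T′ (done colT′))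
    where
    R = T′ - v
    R⊆T₀ : R ⊆ T₀
    R⊆T₀ = T∪⁅v⁆-v⊆T G c (subst (_≤ c) (∣p∪⁅x⁆∣≡1+∣p∣ C v∉C) ∣C∪v∣≤c)
    k≤∣R∣ : k ≤ ∣ R ∣
    k≤∣R∣ = ≤-pred (subst (suc k ≤_) (x∈p⇒∣p∣≡1+∣p-x∣ v∈T′) ∣T′∣>k)
    R→T′ : TARStep k R T′
    R→T′ = subst (TARStep k R) (x∈p⇒p-x∪⁅x⁆≡p v∈T′) (TARStep-insert k (x∉p-x T′ v) k≤∣R∣)
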